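{- Let $q\ge2$ be an integer and let $n,n',k$ be positive integers with $n=kn'$ and $\gcd(n,q)=1$. Set $m'=\mathrm{ord}_{n'}(q)$ and $\pi^*(n'):=\{r\in\pi(n'):\nu_r(n')=\nu_r(q^{m'}-1)\}$. Then $\mathrm{ord}_{kn'}(q)=km'$ if and only if $\pi(k)\subseteq\pi^*(n')$ and, moreover, if $2\in\pi^*(n')$ and $n'\equiv2\pmod4$, then $\nu_2(k)\le1$.
   Context: $\mathrm{ord}_N(q)$ is the least positive integer $e$ with $N\mid q^e-1$. $\pi(N)$ is the set of prime divisors of $N$; for a prime $r$, $\nu_r(N)$ is the largest $i\ge0$ with $r^i\mid N$. -}

module Defs where

open import Data.Nat using (ℕ; zero; suc; _∸_; _^_; _≤_; _<_)
open import Data.Nat.Divisibility using (_∣_)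
open import Data.Nat.Primality using (Prime)
open import Data.Product using (_×_; ∃-syntax)

IsOrd : ℕ → ℕ → ℕ → Set
IsOrd N q e = (0 < e) × (N ∣ q ^ e ∸ 1) × (∀ e′ → 0 < e′ → N ∣ q ^ e′ ∸ 1 → e ≤ e′)

IsVal : ℕ → ℕ → ℕ → Set
IsVal r N i = (r ^ i ∣ N) × (∀ j → r ^ j ∣ N → j ≤ i)

InPi : ℕ → ℕ → Set
InPi r N = Prime r × (r ∣ N)

InPiStar : (q n′ m′ r : ℕ) → Set
InPiStar q n′ m′ r = InPi r n′ × ∃[ i ] (IsVal r n′ i × IsVal r (q ^ m′ ∸ 1) i)

{-# OPTIONS --safe #-}
-- Put a = q^{m′}, so n′ ∣ a − 1. As m′ = ord_{n′}(q) divides every e with k n′ ∣ q^e − 1,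
-- ord_{kn′}(q) = k m′ iff ord_{kn′}(a) = k.
-- Lifting the exponent: if r ∣ N ∣ a − 1 then r N ∣ a^r − 1, so k n′ ∣ a^k − 1 as soon as
-- every prime of k divides n′. If moreover r n′ ∤ a − 1, this exactness survives powers prime
-- to r, and each r-th power multiplies the exact divisor by r (for r = 2 once 4 ∣ N); hence
-- k n′ ∤ a^{k/r} − 1 for every prime r ∣ k, which forces the order to be k.
-- Conversely, a prime r ∣ k with r ∤ n′ is impossible by counting: the k powers a^i (i < k)
-- are distinct modulo k n′ and ≡ 1 (mod n′), so they would exhaust the k residues 1 + j n′,
-- one of which is divisible by r. A prime r ∣ k with r n′ ∣ a − 1, or 4 ∣ k when
-- n′ ≡ 2 (mod 4) and 2 n′ ∤ a − 1 (then 4 n′ ∣ a² − 1), would let the lifting reach k n′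
-- at an exponent below k.
module Submission where

open import Data.Empty using (⊥; ⊥-elim)
open import Data.Fin using (Fin; fromℕ<; toℕ; punchOut) renaming (_<_ to _<ᶠ_)
open import Data.Fin.Properties using (pigeonhole; punchOut-injective; fromℕ<-injective; toℕ<n)
open import Data.List using (_∷_; [])
import Data.List.Relation.Unary.All as All
open import Data.Nat
open import Data.Nat.Combinatorics using (_C_; nC1≡n; nCk+nC[k+1]≡[n+1]C[k+1])
open import Data.Nat.Coprimality using (Coprime; coprime-Bézout; coprime-divisor)
open import Data.Nat.DivMod
open import Data.Nat.Divisibility
open import Data.Nat.GCD using (gcd; gcd[m,n]∣m; gcd[m,n]∣n; gcd[m,n]≢0; gcd-GCD; module Bézout)
open import Data.Nat.Induction using (<-rec)
open import Data.Nat.ListAction using (product)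
open import Data.Nat.Primality
open import Data.Nat.Primality.Factorisation using (factorise)
open import Data.Nat.Properties
open import Data.Nat.Tactic.RingSolver using (solve; solve-∀)
open import Data.Product using (_×_; _,_; proj₁; proj₂; ∃-syntax; ∃₂)
open import Data.Product.Function.NonDependent.Propositional using (_×-⇔_)
open import Data.Sum using (_⊎_; inj₁; inj₂; [_,_]′; map₂)
open import Function using (_∘_)
open import Function.Bundles using (_⇔_; mk⇔; Equivalence)
import Function.Properties.Equivalence as ⇔
open import Function.Related.TypeIsomorphisms using (→-cong-⇔)
open import Relation.Binary.PropositionalEquality
open import Relation.Nullary using (¬_; yes; no; contradiction)

open import Defs

private
  variable
    b e f j k m r s u x z M N : ℕ

*-∸1 : ∀ x y .{{_ : NonZero x}} .{{_ : NonZero y}} → x * y ∸ 1 ≡ x * (y ∸ 1) + (x ∸ 1)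
*-∸1 (suc x) (suc y) = eq
  where
  eq : y + x * suc y ≡ suc x * y + x
  eq = solve (x ∷ y ∷ [])

^-+-∸1 : ∀ b s t .{{_ : NonZero b}} → b ^ (s + t) ∸ 1 ≡ b ^ s * (b ^ t ∸ 1) + (b ^ s ∸ 1)
^-+-∸1 b s t =
  trans (cong (_∸ 1) (^-distribˡ-+-* b s t)) (*-∸1 (b ^ s) (b ^ t) {{m^n≢0 b s}} {{m^n≢0 b t}})

prime∤1 : Prime r → ¬ r ∣ 1
prime∤1 pr r∣1 = ¬prime[1] (subst Prime (∣1⇒≡1 r∣1) pr)

prime⇒1< : Prime r → 1 < r
prime⇒1< {suc (suc _)} _ = s≤s (s≤s z≤n)

¬2∣⇒odd : ¬ 2 ∣ m → m ≡ 1 + m / 2 * 2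
¬2∣⇒odd {m} 2∤m with m % 2 in eq | m%n<n m 2
... | 0 | _ = ⊥-elim (2∤m (m%n≡0⇒n∣m m 2 eq))
... | 1 | _ = trans (m≡m%n+[m/n]*n m 2) (cong (_+ m / 2 * 2) eq)
... | suc (suc _) | s≤s (s≤s ())

prime≢2⇒odd : Prime r → r ≢ 2 → r ≡ 1 + r / 2 * 2
prime≢2⇒odd pr r≢2 = ¬2∣⇒odd λ 2∣r →
  [ (λ ()) , (λ 2≡r → r≢2 (sym 2≡r)) ]′ (prime⇒irreducible pr 2∣r)

even∧%4≢2⇒4∣ : 2 ∣ m → m % 4 ≢ 2 → 4 ∣ m
even∧%4≢2⇒4∣ {m} 2∣m m%4≢2 =
  m%n≡0⇒n∣m m 4 (even-residue (m % 4) (m%n<n m 4) (%-presˡ-∣ 2∣m (divides 2 refl)) m%4≢2)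
  where
  even-residue : ∀ ρ → ρ < 4 → 2 ∣ ρ → ρ ≢ 2 → ρ ≡ 0
  even-residue 0 _ _ _ = refl
  even-residue 1 _ 2∣1 _ = contradiction 2∣1 (prime∤1 prime[2])
  even-residue 2 _ _ 2≢2 = contradiction refl 2≢2
  even-residue 3 _ 2∣3 _ = contradiction (∣m+n∣m⇒∣n 2∣3 ∣-refl) (prime∤1 prime[2])
  even-residue (suc (suc (suc (suc _)))) (s≤s (s≤s (s≤s (s≤s ())))) _ _

∃-prime-divisor : 1 < m → ∃[ p ] Prime p × p ∣ m
∃-prime-divisor {1} (s≤s ())
∃-prime-divisor {m@(suc (suc _))} _ with factorise m
... | record { factors = p ∷ ps ; isFactorisation = m≡p*ps ; factorsPrime = prime-p All.∷ _ } =
  p , prime-p , divides (product ps) (trans m≡p*ps (*-comm p _))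


%-≡⇒∣ : ∀ m n o .{{_ : NonZero o}} → (m + n) % o ≡ n % o → o ∣ m
%-≡⇒∣ m n o eq = ∣m+n∣m⇒∣n (divides ((m + n) / o) [n/o]*o+m≡[m+n]/o*o) (n∣m*n (n / o))
  where
  open ≡-Reasoning
  [n/o]*o+m≡[m+n]/o*o : n / o * o + m ≡ (m + n) / o * o
  [n/o]*o+m≡[m+n]/o*o = +-cancelˡ-≡ (n % o) _ _ (begin
    n % o + (n / o * o + m)          ≡⟨ sym (+-assoc (n % o) _ m) ⟩
    n % o + n / o * o + m            ≡⟨ cong (_+ m) (sym (m≡m%n+[m/n]*n n o)) ⟩
    n + m                            ≡⟨ +-comm n m ⟩
    m + n                            ≡⟨ m≡m%n+[m/n]*n (m + n) o ⟩
    (m + n) % o + (m + n) / o * o    ≡⟨ cong (_+ (m + n) / o * o) eq ⟩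
    n % o + (m + n) / o * o          ∎)

valuation-split : 1 < r → ∀ m → 0 < m → ∃₂ λ e u → m ≡ r ^ e * u × ¬ r ∣ u
valuation-split {r} 1<r = <-rec Split split
  where
  Split : ℕ → Set
  Split m = 0 < m → ∃₂ λ e u → m ≡ r ^ e * u × ¬ r ∣ u
  split : ∀ m → (∀ {n} → n < m → Split n) → Split m
  split m rec 0<m with r ∣? m
  ... | no r∤m = 0 , m , sym (*-identityˡ m) , r∤m
  ... | yes (divides zero m≡0) = contradiction m≡0 (n>0⇒n≢0 0<m)
  ... | yes (divides n@(suc _) m≡n*r) with rec (subst (n <_) (sym m≡n*r) (m<m*n n r 1<r)) z<s
  ...   | e , u , n≡ , r∤u =
    suc e , u , trans m≡n*r (trans (cong (_* r) n≡) (trans (*-comm _ r) (sym (*-assoc r (r ^ e) u)))) , r∤u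

^-monoʳ-∣ : ∀ r → e ≤ f → r ^ e ∣ r ^ f
^-monoʳ-∣ {e} {f} r e≤f = divides (r ^ (f ∸ e))
  (trans (cong (r ^_) (sym (m+[n∸m]≡n e≤f))) (trans (^-distribˡ-+-* r e (f ∸ e)) (*-comm (r ^ e) _)))

IsVal-split : Prime r → m ≡ r ^ e * u → ¬ r ∣ u → IsVal r m e
IsVal-split {r} {m} {e} {u} pr m≡ r∤u = r^e∣m , maximal
  where
  instance _ = prime⇒nonZero pr
  r^e∣m : r ^ e ∣ m
  r^e∣m = divides u (trans m≡ (*-comm (r ^ e) u))
  maximal : ∀ j → r ^ j ∣ m → j ≤ e
  maximal j r^j∣m with j ≤? e
  ... | yes j≤e = j≤e
  ... | no j≰e = contradiction (*-cancelˡ-∣ (r ^ e) {{m^n≢0 r e}} r^e*r∣r^e*u) r∤u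
    where
    r^e*r∣r^e*u : r ^ e * r ∣ r ^ e * u
    r^e*r∣r^e*u = subst₂ _∣_ (*-comm r (r ^ e)) m≡ (∣-trans (^-monoʳ-∣ r (≰⇒> j≰e)) r^j∣m)

∣∸1⇒∣^∸1 : ∀ b .{{_ : NonZero b}} → N ∣ b ∸ 1 → ∀ e → N ∣ b ^ e ∸ 1
∣∸1⇒∣^∸1 b N∣b∸1 zero = _ ∣0
∣∸1⇒∣^∸1 {N} b N∣b∸1 (suc e) =
  subst (N ∣_) (sym (*-∸1 b (b ^ e)))
        (∣m∣n⇒∣m+n (∣n⇒∣m*n b (∣∸1⇒∣^∸1 b N∣b∸1 e)) N∣b∸1)
  where instance _ = m^n≢0 b e

∣^∸1⇒∣^[*]∸1 : ∀ b e .{{_ : NonZero b}} → N ∣ b ^ e ∸ 1 → ∀ f → N ∣ b ^ (f * e) ∸ 1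
∣^∸1⇒∣^[*]∸1 {N} b e N∣b^e∸1 f =
  subst (λ g → N ∣ g ∸ 1) (trans (^-*-assoc b e f) (cong (b ^_) (*-comm e f)))
        (∣∸1⇒∣^∸1 (b ^ e) {{m^n≢0 b e}} N∣b^e∸1 f)

∣^∸1-cancel : ∀ b s t .{{_ : NonZero b}} → N ∣ b ^ (s + t) ∸ 1 → N ∣ b ^ t ∸ 1 → N ∣ b ^ s ∸ 1
∣^∸1-cancel {N} b s t N∣b^[s+t]∸1 N∣b^t∸1 =
  ∣m+n∣m⇒∣n (subst (N ∣_) (^-+-∸1 b s t) N∣b^[s+t]∸1) (∣n⇒∣m*n (b ^ s) N∣b^t∸1)

∣^∸1-gcd : ∀ b s t .{{_ : NonZero b}} → N ∣ b ^ s ∸ 1 → N ∣ b ^ t ∸ 1 → N ∣ b ^ gcd s t ∸ 1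
∣^∸1-gcd {N} b s t N∣b^s∸1 N∣b^t∸1 with Bézout.identity (gcd-GCD s t)
... | Bézout.+- x y g+yt≡xs = ∣^∸1-cancel b (gcd s t) (y * t)
  (subst (λ e → N ∣ b ^ e ∸ 1) (sym g+yt≡xs) (∣^∸1⇒∣^[*]∸1 b s N∣b^s∸1 x))
  (∣^∸1⇒∣^[*]∸1 b t N∣b^t∸1 y)
... | Bézout.-+ x y g+xs≡yt = ∣^∸1-cancel b (gcd s t) (x * s)
  (subst (λ e → N ∣ b ^ e ∸ 1) (sym g+xs≡yt) (∣^∸1⇒∣^[*]∸1 b t N∣b^t∸1 y))
  (∣^∸1⇒∣^[*]∸1 b s N∣b^s∸1 x)

∣^∸1⇒coprime-^ : ∀ b .{{_ : NonZero b}} → N ∣ b ^ e ∸ 1 → s ≤ e → Coprime N (b ^ s)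
∣^∸1⇒coprime-^ {N} {e} {s} b N∣b^e∸1 s≤e {d} (d∣N , d∣b^s) =
  ∣1⇒≡1 (∣m+n∣m⇒∣n (subst (d ∣_) (sym (m∸n+n≡m (m^n>0 b e))) d∣b^e) (∣-trans d∣N N∣b^e∸1))
  where
  d∣b^e : d ∣ b ^ e
  d∣b^e = subst (d ∣_) (trans (sym (^-distribˡ-+-* b s (e ∸ s))) (cong (b ^_) (m+[n∸m]≡n s≤e)))
                (∣m⇒∣m*n (b ^ (e ∸ s)) d∣b^s)

IsOrd⇒∣ : .{{_ : NonZero b}} → IsOrd N b e → ∀ s → N ∣ b ^ s ∸ 1 → e ∣ s
IsOrd⇒∣ {b} {N} {e} (0<e , N∣b^e∸1 , minimal) s N∣b^s∸1 = subst (_∣ s) gcd≡e (gcd[m,n]∣n e s)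
  where
  instance _ = >-nonZero 0<e
  gcd≡e : gcd e s ≡ e
  gcd≡e = ≤-antisym (∣⇒≤ (gcd[m,n]∣m e s))
    (minimal (gcd e s) (n≢0⇒n>0 (gcd[m,n]≢0 e s (inj₁ (n>0⇒n≢0 0<e))))
             (∣^∸1-gcd b e s N∣b^e∸1 N∣b^s∸1))

IsOrd-criterion : .{{_ : NonZero b}} → 0 < e → N ∣ b ^ e ∸ 1 →
  (∀ r c → Prime r → e ≡ c * r → ¬ N ∣ b ^ c ∸ 1) → IsOrd N b e
IsOrd-criterion {b} {e} {N} 0<e N∣b^e∸1 no-cofactor = 0<e , N∣b^e∸1 , minimal
  where
  minimal : ∀ s → 0 < s → N ∣ b ^ s ∸ 1 → e ≤ s
  minimal s 0<s N∣b^s∸1 with gcd[m,n]∣n s e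
  ... | divides zero e≡0 = contradiction e≡0 (n>0⇒n≢0 0<e)
  ... | divides 1 e≡g =
    ∣⇒≤ {{>-nonZero 0<s}} (subst (_∣ s) (sym (trans e≡g (*-identityˡ _))) (gcd[m,n]∣m s e))
  ... | divides d@(suc (suc _)) e≡dg with ∃-prime-divisor {d} (s≤s (s≤s z≤n))
  ...   | r , prime-r , divides d′ d≡d′r =
    contradiction (∣^∸1⇒∣^[*]∸1 b (gcd s e) (∣^∸1-gcd b s e N∣b^s∸1 N∣b^e∸1) d′)
                  (no-cofactor r (d′ * gcd s e) prime-r e≡d′gr)
    where
    e≡d′gr : e ≡ d′ * gcd s e * r
    e≡d′gr = trans e≡dg (trans (cong (_* gcd s e) d≡d′r)
               (trans (*-assoc d′ r _) (trans (cong (d′ *_) (*-comm r _)) (sym (*-assoc d′ _ r)))))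

IsOrd-^⇔ : .{{_ : NonZero b}} → IsOrd M b m → M ∣ N → IsOrd N b (k * m) ⇔ IsOrd N (b ^ m) k
IsOrd-^⇔ {b} {M} {m} {N} {k} ord-M@(0<m , _ , _) M∣N = mk⇔ to from
  where
  instance _ = >-nonZero 0<m
  b^[f*m]≡ : ∀ f → b ^ (f * m) ≡ (b ^ m) ^ f
  b^[f*m]≡ f = trans (cong (b ^_) (*-comm f m)) (sym (^-*-assoc b m f))
  to : IsOrd N b (k * m) → IsOrd N (b ^ m) k
  to (0<km , N∣b^km∸1 , minimal) = 0<k , subst (λ g → N ∣ g ∸ 1) (b^[f*m]≡ k) N∣b^km∸1 , minimal′
    where
    0<k : 0 < k
    0<k = n≢0⇒n>0 λ k≡0 → n>0⇒n≢0 0<km (cong (_* m) k≡0)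
    minimal′ : ∀ f → 0 < f → N ∣ (b ^ m) ^ f ∸ 1 → k ≤ f
    minimal′ f 0<f N∣b^mf∸1 = *-cancelʳ-≤ k f m
      (minimal (f * m) (*-mono-≤ 0<f 0<m) (subst (λ g → N ∣ g ∸ 1) (sym (b^[f*m]≡ f)) N∣b^mf∸1))
  from : IsOrd N (b ^ m) k → IsOrd N b (k * m)
  from (0<k , N∣b^mk∸1 , minimal) =
    *-mono-≤ 0<k 0<m , subst (λ g → N ∣ g ∸ 1) (sym (b^[f*m]≡ k)) N∣b^mk∸1 , minimal′
    where
    minimal′ : ∀ s → 0 < s → N ∣ b ^ s ∸ 1 → k * m ≤ s
    minimal′ s 0<s N∣b^s∸1 with IsOrd⇒∣ ord-M s (∣-trans M∣N N∣b^s∸1)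
    ... | divides f refl = *-monoˡ-≤ m (minimal f 0<f (subst (λ g → N ∣ g ∸ 1) (b^[f*m]≡ f) N∣b^s∸1))
      where
      0<f : 0 < f
      0<f = n≢0⇒n>0 λ f≡0 → n>0⇒n≢0 0<s (cong (_* m) f≡0)

[1+n]C2≡n+nC2 : ∀ n → suc n C 2 ≡ n + n C 2
[1+n]C2≡n+nC2 n = trans (sym (nCk+nC[k+1]≡[n+1]C[k+1] n 1)) (cong (_+ n C 2) (nC1≡n n))

[1+h*2]C2≡[1+h*2]*h : ∀ h → (1 + h * 2) C 2 ≡ (1 + h * 2) * h
[1+h*2]C2≡[1+h*2]*h zero = refl
[1+h*2]C2≡[1+h*2]*h (suc h) = begin
  (3 + h * 2) C 2                                ≡⟨ [1+n]C2≡n+nC2 (2 + h * 2) ⟩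
  (2 + h * 2) + (2 + h * 2) C 2                  ≡⟨ cong ((2 + h * 2) +_) ([1+n]C2≡n+nC2 (1 + h * 2)) ⟩
  (2 + h * 2) + ((1 + h * 2) + (1 + h * 2) C 2)  ≡⟨ cong (λ c → (2 + h * 2) + ((1 + h * 2) + c))
                                                         ([1+h*2]C2≡[1+h*2]*h h) ⟩
  (2 + h * 2) + ((1 + h * 2) + (1 + h * 2) * h)  ≡⟨ solve (h ∷ []) ⟩
  (3 + h * 2) * suc h                            ∎
  where open ≡-Reasoning

[1+x]^n-expansion : ∀ x n → ∃[ w ] suc x ^ n ≡ 1 + x * (n + x * (n C 2 + x * w))
[1+x]^n-expansion x zero = 0 , cong suc (sym x*[x*x*0]≡0)
  where
  x*[x*x*0]≡0 : x * (0 + x * (0 + x * 0)) ≡ 0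
  x*[x*x*0]≡0 = solve (x ∷ [])
[1+x]^n-expansion x (suc n) with [1+x]^n-expansion x n
... | w , eq = w′ , (begin
  suc x * suc x ^ n                                  ≡⟨ cong (suc x *_) eq ⟩
  suc x * (1 + x * (n + x * (n C 2 + x * w)))        ≡⟨ multiply x n (n C 2) w ⟩
  1 + x * (suc n + x * ((n + n C 2) + x * w′))       ≡⟨ cong (λ c → 1 + x * (suc n + x * (c + x * w′)))
                                                           (sym ([1+n]C2≡n+nC2 n)) ⟩
  1 + x * (suc n + x * (suc n C 2 + x * w′))         ∎)
  where
  open ≡-Reasoning
  w′ = n C 2 + w + x * w
  multiply : ∀ x n c w →
    suc x * (1 + x * (n + x * (c + x * w))) ≡ 1 + x * (suc n + x * ((n + c) + x * (c + w + x * w)))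
  multiply = solve-∀

[1+x]^n∸1-linear : ∀ x n → ∃[ t ] suc x ^ n ∸ 1 ≡ x * (n + x * t)
[1+x]^n∸1-linear x n with [1+x]^n-expansion x n
... | w , eq = n C 2 + x * w , cong (_∸ 1) eq

[1+x]^r∸1-odd-prime : Prime r → r ≢ 2 → r ∣ x → ∃[ s ] suc x ^ r ∸ 1 ≡ r * x * (1 + r * s)
[1+x]^r∸1-odd-prime {r} pr r≢2 (divides z refl) with [1+x]^n-expansion (z * r) r
... | w , eq = z * h + z * z * w , (begin
  suc (z * r) ^ r ∸ 1                                    ≡⟨ cong (_∸ 1) eq ⟩
  z * r * (r + z * r * (r C 2 + z * r * w))              ≡⟨ cong (λ c → z * r * (r + z * r * (c + z * r * w))) rC2≡r*h ⟩
  z * r * (r + z * r * (r * h + z * r * w))              ≡⟨ factor r z h w ⟩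
  r * (z * r) * (1 + r * (z * h + z * z * w))            ∎)
  where
  open ≡-Reasoning
  h = r / 2
  rC2≡r*h : r C 2 ≡ r * h
  rC2≡r*h = trans (cong (_C 2) r≡1+h*2) (trans ([1+h*2]C2≡[1+h*2]*h h) (cong (_* h) (sym r≡1+h*2)))
    where r≡1+h*2 = prime≢2⇒odd pr r≢2
  factor : ∀ r z h w →
    z * r * (r + z * r * (r * h + z * r * w)) ≡ r * (z * r) * (1 + r * (z * h + z * z * w))
  factor = solve-∀

[1+x]^2∸1≡x*[2+x] : ∀ x → suc x ^ 2 ∸ 1 ≡ x * (2 + x)
[1+x]^2∸1≡x*[2+x] x = eq
  where
  eq : x * 1 + x * suc (x * 1) ≡ x * (2 + x)
  eq = solve (x ∷ [])

[1+x]^2∸1-4∣x : 4 ∣ x → ∃[ s ] suc x ^ 2 ∸ 1 ≡ 2 * x * (1 + 2 * s)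
[1+x]^2∸1-4∣x (divides w refl) = w , trans ([1+x]^2∸1≡x*[2+x] (w * 4)) (factor w)
  where
  factor : ∀ w → w * 4 * (2 + w * 4) ≡ 2 * (w * 4) * (1 + 2 * w)
  factor = solve-∀

[1+x]^r∸1-prime : Prime r → r ∣ x → r ≢ 2 ⊎ 4 ∣ x → ∃[ s ] suc x ^ r ∸ 1 ≡ r * x * (1 + r * s)
[1+x]^r∸1-prime pr r∣x (inj₁ r≢2) = [1+x]^r∸1-odd-prime pr r≢2 r∣x
[1+x]^r∸1-prime {r} pr r∣x (inj₂ 4∣x) with r ≟ 2
... | yes refl = [1+x]^2∸1-4∣x 4∣x
... | no r≢2 = [1+x]^r∸1-odd-prime pr r≢2 r∣x

∣∸1⇒r*∣^r∸1 : ∀ b .{{_ : NonZero b}} → r ∣ N → N ∣ b ∸ 1 → r * N ∣ b ^ r ∸ 1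
∣∸1⇒r*∣^r∸1 {r} {N} (suc x) r∣N (divides y refl) with [1+x]^n∸1-linear (y * N) r
... | t , eq = subst₂ _∣_ (*-comm N r) (sym eq)
  (*-pres-∣ (n∣m*n y) (∣m∣n⇒∣m+n ∣-refl (∣m⇒∣m*n t (∣n⇒∣m*n y r∣N))))

∣∸1⇒k*∣^k∸1 : ∀ b .{{_ : NonZero b}} → N ∣ b ∸ 1 →
  ∀ k → (∀ p → Prime p → p ∣ k → p ∣ N) → k * N ∣ b ^ k ∸ 1
∣∸1⇒k*∣^k∸1 {N} b N∣b∸1 = <-rec Lifts lifts
  where
  Lifts : ℕ → Set
  Lifts k = (∀ p → Prime p → p ∣ k → p ∣ N) → k * N ∣ b ^ k ∸ 1
  lifts : ∀ k → (∀ {c} → c < k → Lifts c) → Lifts k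
  lifts 0 _ _ = 0 ∣0
  lifts 1 _ _ = subst₂ (λ M g → M ∣ g ∸ 1) (sym (*-identityˡ N)) (sym (^-identityʳ b)) N∣b∸1
  lifts k@(suc (suc _)) rec primes∣N with ∃-prime-divisor {k} (s≤s (s≤s z≤n))
  ... | p , prime-p , divides zero ()
  ... | p , prime-p , divides c@(suc _) k≡c*p =
    subst₂ (λ M g → M ∣ g ∸ 1) p*[c*N]≡k*N [b^c]^p≡b^k
      (∣∸1⇒r*∣^r∸1 (b ^ c) {{m^n≢0 b c}} p∣c*N
        (rec c<k λ q prime-q q∣c → primes∣N q prime-q (∣-trans q∣c c∣k)))
    where
    c<k : c < k
    c<k = subst (c <_) (sym k≡c*p) (m<m*n c p (prime⇒1< prime-p))
    c∣k : c ∣ k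
    c∣k = divides p (trans k≡c*p (*-comm c p))
    p∣c*N : p ∣ c * N
    p∣c*N = ∣n⇒∣m*n c (primes∣N p prime-p (divides c k≡c*p))
    p*[c*N]≡k*N : p * (c * N) ≡ k * N
    p*[c*N]≡k*N = trans (sym (*-assoc p c N)) (cong (_* N) (trans (*-comm p c) (sym k≡c*p)))
    [b^c]^p≡b^k : (b ^ c) ^ p ≡ b ^ k
    [b^c]^p≡b^k = trans (^-*-assoc b c p) (cong (b ^_) (sym k≡c*p))

ExactlyDivides : ℕ → ℕ → ℕ → Set
ExactlyDivides r N x = N ∣ x × ¬ r * N ∣ x

exact⇒nonZero : ExactlyDivides r N x → NonZero N
exact⇒nonZero {r} {zero} (divides y refl , r*0∤y*0) =
  contradiction (subst₂ _∣_ (sym (*-zeroʳ r)) (sym (*-zeroʳ y)) ∣-refl) r*0∤y*0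
exact⇒nonZero {N = suc _} _ = _

exact-*ˡ : ∀ m .{{_ : NonZero m}} → ExactlyDivides r N x → ExactlyDivides r (m * N) (m * x)
exact-*ˡ {r} {N} {x} m (N∣x , rN∤x) = *-monoʳ-∣ m N∣x , λ r[mN]∣mx →
  rN∤x (*-cancelˡ-∣ m (subst (_∣ m * x) (r[mN]≡m[rN] r m N) r[mN]∣mx))
  where
  r[mN]≡m[rN] : ∀ r m N → r * (m * N) ≡ m * (r * N)
  r[mN]≡m[rN] = solve-∀

exact-*ʳ : Prime r → ¬ r ∣ z → ExactlyDivides r N x → ExactlyDivides r N (x * z)
exact-*ʳ {r} {z} {N} pr r∤z ex@(divides y refl , rN∤yN) = ∣m⇒∣m*n z (proj₁ ex) , λ rN∣yNz →
  [ r∤y , r∤z ]′ (euclidsLemma y z pr (*-cancelʳ-∣ N (subst (r * N ∣_) (yNz≡yzN y N z) rN∣yNz)))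
  where
  instance _ = exact⇒nonZero {r} ex
  r∤y : ¬ r ∣ y
  r∤y r∣y = rN∤yN (*-monoˡ-∣ N r∣y)
  yNz≡yzN : ∀ y N z → y * N * z ≡ y * z * N
  yNz≡yzN = solve-∀

exact-^-coprime : ∀ b .{{_ : NonZero b}} → Prime r → r ∣ N → ¬ r ∣ u →
  ExactlyDivides r N (b ∸ 1) → ExactlyDivides r N (b ^ u ∸ 1)
exact-^-coprime {r} {N} {u} (suc x) pr r∣N r∤u ex with [1+x]^n∸1-linear x u
... | t , eq = subst (ExactlyDivides r N) (sym eq) (exact-*ʳ pr r∤u+xt ex)
  where
  r∤u+xt : ¬ r ∣ u + x * t
  r∤u+xt r∣u+xt =
    r∤u (∣m+n∣m⇒∣n (subst (r ∣_) (+-comm u (x * t)) r∣u+xt) (∣m⇒∣m*n t (∣-trans r∣N (proj₁ ex))))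

exact-^-prime : ∀ b .{{_ : NonZero b}} → Prime r → r ∣ N → r ≢ 2 ⊎ 4 ∣ N →
  ExactlyDivides r N (b ∸ 1) → ExactlyDivides r (r * N) (b ^ r ∸ 1)
exact-^-prime {r} {N} (suc x) pr r∣N r≢2⊎4∣N ex@(N∣x , _)
  with [1+x]^r∸1-prime pr (∣-trans r∣N N∣x) (map₂ (λ 4∣N → ∣-trans 4∣N N∣x) r≢2⊎4∣N)
... | s , eq = subst (ExactlyDivides r (r * N)) (sym eq) (exact-*ʳ pr r∤1+rs (exact-*ˡ {r} r ex))
  where
  instance _ = prime⇒nonZero pr
  r∤1+rs : ¬ r ∣ 1 + r * s
  r∤1+rs r∣1+rs = prime∤1 pr (∣m+n∣m⇒∣n (subst (r ∣_) (+-comm 1 (r * s)) r∣1+rs) (m∣m*n s))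

-- For r = 2 the hypothesis 4 ∣ N is only needed for the first squaring: afterwards 4 ∣ 2 ^ j * N.
exact-^-prime-power : ∀ b .{{_ : NonZero b}} → Prime r → r ∣ N → ExactlyDivides r N (b ∸ 1) →
  ∀ j → (0 < j → r ≢ 2 ⊎ 4 ∣ N) → ExactlyDivides r (r ^ j * N) (b ^ r ^ j ∸ 1)
exact-^-prime-power {r} {N} b pr r∣N ex zero _ =
  subst₂ (λ M g → ExactlyDivides r M (g ∸ 1)) (sym (*-identityˡ N)) (sym (^-identityʳ b)) ex
exact-^-prime-power {r} {N} b pr r∣N ex (suc j) r≢2⊎4∣N =
  subst₂ (λ M g → ExactlyDivides r M (g ∸ 1)) (sym (*-assoc r (r ^ j) N)) [b^r^j]^r≡b^r^[1+j]
    (exact-^-prime (b ^ r ^ j) {{m^n≢0 b (r ^ j)}} pr (∣n⇒∣m*n (r ^ j) r∣N)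
      (map₂ (∣n⇒∣m*n (r ^ j)) (r≢2⊎4∣N z<s))
      (exact-^-prime-power b pr r∣N ex j λ _ → r≢2⊎4∣N z<s))
  where
  [b^r^j]^r≡b^r^[1+j] : (b ^ r ^ j) ^ r ≡ b ^ r ^ suc j
  [b^r^j]^r≡b^r^[1+j] = trans (^-*-assoc b (r ^ j) r) (cong (b ^_) (*-comm (r ^ j) r))

exact⇒¬∣^cofactor : ∀ b .{{_ : NonZero b}} .{{_ : NonZero k}} → Prime r → r ∣ N →
  ExactlyDivides r N (b ∸ 1) → (r ≡ 2 → 4 ∣ k → 4 ∣ N) → ∀ c → k ≡ c * r → ¬ k * N ∣ b ^ c ∸ 1
exact⇒¬∣^cofactor {k} {r} {N} b pr r∣N ex 4∣k⇒4∣N c k≡c*r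
  with valuation-split (prime⇒1< pr) k (>-nonZero⁻¹ k)
... | zero , u , k≡u , r∤u =
  contradiction (subst (r ∣_) (trans k≡u (*-identityˡ u)) (divides c k≡c*r)) r∤u
... | suc e , u , k≡r^[1+e]*u , r∤u = λ kN∣b^c∸1 →
  proj₂ (exact-^-prime-power (b ^ u) {{m^n≢0 b u}} pr r∣N (exact-^-coprime b pr r∣N r∤u ex) e r≢2⊎4∣N)
        (∣-trans r^[1+e]N∣kN (subst (λ g → k * N ∣ g ∸ 1) b^c≡[b^u]^r^e kN∣b^c∸1))
  where
  instance _ = prime⇒nonZero pr
  rearrange : ∀ r a u → r * a * u ≡ a * u * r
  rearrange = solve-∀
  c≡r^e*u : c ≡ r ^ e * u
  c≡r^e*u = *-cancelʳ-≡ c (r ^ e * u) r (trans (sym k≡c*r) (trans k≡r^[1+e]*u (rearrange r (r ^ e) u)))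
  b^c≡[b^u]^r^e : b ^ c ≡ (b ^ u) ^ r ^ e
  b^c≡[b^u]^r^e = trans (cong (b ^_) (trans c≡r^e*u (*-comm (r ^ e) u))) (sym (^-*-assoc b u (r ^ e)))
  r^[1+e]N∣kN : r * (r ^ e * N) ∣ k * N
  r^[1+e]N∣kN = divides u (trans (cong (_* N) k≡r^[1+e]*u) (regroup r (r ^ e) u N))
    where
    regroup : ∀ r a u N → r * a * u * N ≡ u * (r * (a * N))
    regroup = solve-∀
  r≢2⊎4∣N : 0 < e → r ≢ 2 ⊎ 4 ∣ N
  r≢2⊎4∣N 0<e with r ≟ 2
  ... | no r≢2 = inj₁ r≢2
  ... | yes r≡2 =
    inj₂ (4∣k⇒4∣N r≡2 (∣-trans 4∣r^[1+e] (divides u (trans k≡r^[1+e]*u (*-comm _ u)))))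
    where
    4∣r^[1+e] : 4 ∣ r ^ suc e
    4∣r^[1+e] = subst (λ r → 4 ∣ r ^ suc e) (sym r≡2) (^-monoʳ-∣ 2 (s≤s 0<e))

-- r ∈ π*(N) for x = q^{m′} − 1: given N ∣ x, ν_r(N) = ν_r(x) amounts to r N ∤ x.
StarPrime : ℕ → ℕ → ℕ → Set
StarPrime N x r = Prime r × r ∣ N × ExactlyDivides r N x

4*N∣^2∸1 : ∀ b .{{_ : NonZero b}} → ExactlyDivides 2 N (b ∸ 1) → N % 4 ≡ 2 → 4 * N ∣ b ^ 2 ∸ 1
4*N∣^2∸1 {N} (suc x) (divides y refl , 2N∤yN) N%4≡2 =
  subst₂ _∣_ (*-comm N 4) (sym ([1+x]^2∸1≡x*[2+x] (y * N))) (*-pres-∣ (n∣m*n y) 4∣2+yN)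
  where
  h = y / 2
  q = N / 4
  y≡1+h*2 : y ≡ 1 + h * 2
  y≡1+h*2 = ¬2∣⇒odd λ 2∣y → 2N∤yN (*-monoˡ-∣ N 2∣y)
  N≡2+q*4 : N ≡ 2 + q * 4
  N≡2+q*4 = trans (m≡m%n+[m/n]*n N 4) (cong (_+ q * 4) N%4≡2)
  expand : ∀ h q → 2 + (1 + h * 2) * (2 + q * 4) ≡ (1 + q + h + 2 * h * q) * 4
  expand = solve-∀
  4∣2+yN : 4 ∣ 2 + y * N
  4∣2+yN = divides (1 + q + h + 2 * h * q)
    (trans (cong₂ (λ u v → 2 + u * v) y≡1+h*2 N≡2+q*4) (expand h q))

avoiding⇒collision : ∀ {n} (f : Fin n → Fin n) j → (∀ i → f i ≢ j) →
  ∃₂ λ i i′ → i <ᶠ i′ × f i ≡ f i′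
avoiding⇒collision {suc n} f j f≢j with pigeonhole (n<1+n n) (λ i → punchOut (f≢j i ∘ sym))
... | i , i′ , i<i′ , eq = i , i′ , i<i′ , punchOut-injective (f≢j i ∘ sym) (f≢j i′ ∘ sym) eq

1+m*N-divMod : ∀ m n N .{{_ : NonZero n}} → 1 + m * N ≡ m / n * (n * N) + (1 + m % n * N)
1+m*N-divMod m n N = trans (cong (λ i → 1 + i * N) (m≡m%n+[m/n]*n m n)) (regroup (m % n) (m / n) n N)
  where
  regroup : ∀ ρ q n N → 1 + (ρ + q * n) * N ≡ q * (n * N) + (1 + ρ * N)
  regroup = solve-∀

∃-1+jN-multiple : Prime r → ¬ r ∣ N → ∃[ j ] j < r × r ∣ 1 + j * N
∃-1+jN-multiple {zero} ()
∃-1+jN-multiple {r@(suc r′)} {N} pr r∤N = reduce (witness (coprime-Bézout coprime))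
  where
  coprime : Coprime N r
  coprime {d} (d∣N , d∣r) with prime⇒irreducible pr d∣r
  ... | inj₁ d≡1 = d≡1
  ... | inj₂ refl = contradiction d∣N r∤N
  witness : Bézout.Identity 1 N r → ∃[ j ] r ∣ 1 + j * N
  witness (Bézout.-+ x y 1+xN≡yr) = x , divides y 1+xN≡yr
  witness (Bézout.+- x y 1+yr≡xN) = r′ * x , divides (1 + r′ * y) (begin
    1 + r′ * x * N            ≡⟨ cong suc (*-assoc r′ x N) ⟩
    1 + r′ * (x * N)          ≡⟨ cong (λ v → 1 + r′ * v) (sym 1+yr≡xN) ⟩
    1 + r′ * (1 + y * r)      ≡⟨ solve (r′ ∷ y ∷ []) ⟩
    (1 + r′ * y) * r          ∎)
    where open ≡-Reasoning
  reduce : ∃[ j ] r ∣ 1 + j * N → ∃[ j ] j < r × r ∣ 1 + j * N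
  reduce (j , r∣1+jN) = j % r , m%n<n j r ,
    ∣m+n∣m⇒∣n (subst (r ∣_) (1+m*N-divMod j r N) r∣1+jN) (∣n⇒∣m*n (j / r) (m∣m*n N))

-- The counting runs over the quotients (b ^ i ∸ 1) / N modulo k: they are distinct for i < k,
-- yet miss every j with r ∣ 1 + j N when r ∣ k, since r ∤ b ^ i.
module _ {b N k : ℕ} .{{_ : NonZero b}} .{{_ : NonZero N}}
         (N∣b∸1 : N ∣ b ∸ 1) (ord : IsOrd (k * N) b k) where
  private
    instance
      k≢0 : NonZero k
      k≢0 = >-nonZero (proj₁ ord)

    kN∣b^k∸1 : k * N ∣ b ^ k ∸ 1
    kN∣b^k∸1 = proj₁ (proj₂ ord)

    minimal : ∀ e → 0 < e → k * N ∣ b ^ e ∸ 1 → k ≤ e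
    minimal = proj₂ (proj₂ ord)

    quot : ℕ → ℕ
    quot i = (b ^ i ∸ 1) / N

    quot*N≡ : ∀ i → quot i * N ≡ b ^ i ∸ 1
    quot*N≡ i = m/n*n≡m (∣∸1⇒∣^∸1 b N∣b∸1 i)

    b^i≡1+quot*N : ∀ i → b ^ i ≡ 1 + quot i * N
    b^i≡1+quot*N i = trans (sym (m∸n+n≡m (m^n>0 b i))) (trans (+-comm _ 1) (cong suc (sym (quot*N≡ i))))

    quot-+ : ∀ i d → quot (i + d) ≡ b ^ i * quot d + quot i
    quot-+ i d = *-cancelʳ-≡ _ _ N (begin
      quot (i + d) * N                     ≡⟨ quot*N≡ (i + d) ⟩
      b ^ (i + d) ∸ 1                      ≡⟨ ^-+-∸1 b i d ⟩
      b ^ i * (b ^ d ∸ 1) + (b ^ i ∸ 1)    ≡⟨ sym (cong₂ (λ u v → b ^ i * u + v) (quot*N≡ d) (quot*N≡ i)) ⟩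
      b ^ i * (quot d * N) + quot i * N    ≡⟨ cong (_+ quot i * N) (sym (*-assoc (b ^ i) (quot d) N)) ⟩
      b ^ i * quot d * N + quot i * N      ≡⟨ sym (*-distribʳ-+ N (b ^ i * quot d) (quot i)) ⟩
      (b ^ i * quot d + quot i) * N        ∎)
      where open ≡-Reasoning

    label : Fin k → Fin k
    label i = quot (toℕ i) mod k

    quot-distinct : ∀ i i′ → i < i′ → i′ < k → quot i % k ≢ quot i′ % k
    quot-distinct i i′ i<i′ i′<k eq = <⇒≱ δ<k (minimal δ (m<n⇒0<n∸m i<i′) kN∣b^δ∸1)
      where
      δ = i′ ∸ i
      δ<k : δ < k
      δ<k = ≤-<-trans (m∸n≤m i′ i) i′<k
      k∣b^i*quot-δ : k ∣ b ^ i * quot δ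
      k∣b^i*quot-δ = %-≡⇒∣ (b ^ i * quot δ) (quot i) k
        (trans (cong (_% k) (sym (trans (cong quot (sym (m+[n∸m]≡n (<⇒≤ i<i′)))) (quot-+ i δ)))) (sym eq))
      k∣quot-δ : k ∣ quot δ
      k∣quot-δ = coprime-divisor
        (∣^∸1⇒coprime-^ b (∣-trans (m∣m*n N) kN∣b^k∸1) (<⇒≤ (<-trans i<i′ i′<k))) k∣b^i*quot-δ
      kN∣b^δ∸1 : k * N ∣ b ^ δ ∸ 1
      kN∣b^δ∸1 = subst (k * N ∣_) (quot*N≡ δ) (*-monoˡ-∣ N k∣quot-δ)

    quot-avoids : Prime r → r ∣ k → r ∣ 1 + j * N → ∀ i → i ≤ k → quot i % k ≢ j
    quot-avoids {r} {j} pr r∣k r∣1+jN i i≤k quot%k≡j = prime∤1 pr (∣-reflexive r≡1)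
      where
      r∣b^i : r ∣ b ^ i
      r∣b^i = subst (r ∣_) (sym (trans (b^i≡1+quot*N i) (1+m*N-divMod (quot i) k N)))
        (∣m∣n⇒∣m+n (∣n⇒∣m*n (quot i / k) (∣m⇒∣m*n N r∣k))
                   (subst (λ j → r ∣ 1 + j * N) (sym quot%k≡j) r∣1+jN))
      r≡1 : r ≡ 1
      r≡1 = ∣^∸1⇒coprime-^ b kN∣b^k∸1 i≤k (∣m⇒∣m*n N r∣k , r∣b^i)

  IsOrd⇒prime∣ : Prime r → r ∣ k → r ∣ N
  IsOrd⇒prime∣ {r} pr r∣k with r ∣? N
  ... | yes r∣N = r∣N
  ... | no r∤N with ∃-1+jN-multiple pr r∤N
  ...   | j , j<r , r∣1+jN = ⊥-elim (no-collision (avoiding⇒collision label (fromℕ< j<k) label≢j))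
    where
    j<k : j < k
    j<k = <-≤-trans j<r (∣⇒≤ r∣k)
    label≢j : ∀ i → label i ≢ fromℕ< j<k
    label≢j i eq = quot-avoids pr r∣k r∣1+jN (toℕ i) (<⇒≤ (toℕ<n i)) (fromℕ<-injective _ _ _ _ eq)
    no-collision : ¬ (∃₂ λ i i′ → i <ᶠ i′ × label i ≡ label i′)
    no-collision (i , i′ , i<i′ , eq) =
      quot-distinct (toℕ i) (toℕ i′) i<i′ (toℕ<n i′) (fromℕ<-injective _ _ _ _ eq)

  IsOrd⇒¬shortcut : ∀ c d e → k ≡ c * d → 0 < e → e < d → d * N ∣ b ^ e ∸ 1 → ⊥
  IsOrd⇒¬shortcut c d e k≡c*d 0<e e<d dN∣b^e∸1 =
    <⇒≱ ec<k (minimal (e * c) (*-mono-≤ 0<e 0<c) kN∣b^ec∸1)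
    where
    0<c : 0 < c
    0<c = n≢0⇒n>0 λ c≡0 → ≢-nonZero⁻¹ k (trans k≡c*d (cong (_* d) c≡0))
    ec<k : e * c < k
    ec<k = subst (e * c <_) (trans (*-comm d c) (sym k≡c*d)) (*-monoˡ-< c {{>-nonZero 0<c}} e<d)
    c∣k : c ∣ k
    c∣k = divides d (trans k≡c*d (*-comm c d))
    kN∣b^ec∸1 : k * N ∣ b ^ (e * c) ∸ 1
    kN∣b^ec∸1 = subst₂ (λ M g → M ∣ g ∸ 1)
      (trans (sym (*-assoc c d N)) (cong (_* N) (sym k≡c*d))) (^-*-assoc b e c)
      (∣∸1⇒k*∣^k∸1 (b ^ e) {{m^n≢0 b e}} dN∣b^e∸1 c λ p prime-p p∣c →
        ∣n⇒∣m*n d (IsOrd⇒prime∣ prime-p (∣-trans p∣c c∣k)))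

  IsOrd⇒star : Prime r → r ∣ k → StarPrime N (b ∸ 1) r
  IsOrd⇒star {r} pr r∣k@(divides c k≡c*r) = pr , IsOrd⇒prime∣ pr r∣k , N∣b∸1 , λ rN∣b∸1 →
    IsOrd⇒¬shortcut c r 1 k≡c*r z<s (prime⇒1< pr)
      (subst (λ g → r * N ∣ g ∸ 1) (sym (^-identityʳ b)) rN∣b∸1)

  IsOrd⇒¬4∣ : StarPrime N (b ∸ 1) 2 → N % 4 ≡ 2 → ¬ 4 ∣ k
  IsOrd⇒¬4∣ (_ , _ , exact) N%4≡2 (divides c k≡c*4) =
    IsOrd⇒¬shortcut c 4 2 k≡c*4 z<s (s≤s (s≤s (s≤s z≤n))) (4*N∣^2∸1 b exact N%4≡2)

star⇒IsOrd : .{{_ : NonZero b}} .{{_ : NonZero k}} → N ∣ b ∸ 1 →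
  (∀ r → Prime r → r ∣ k → StarPrime N (b ∸ 1) r) →
  (StarPrime N (b ∸ 1) 2 → N % 4 ≡ 2 → ¬ 4 ∣ k) → IsOrd (k * N) b k
star⇒IsOrd {b} {k} {N} N∣b∸1 stars 2-star⇒4∤k =
  IsOrd-criterion (>-nonZero⁻¹ k)
    (∣∸1⇒k*∣^k∸1 b N∣b∸1 k λ p prime-p p∣k → proj₁ (proj₂ (stars p prime-p p∣k))) no-cofactor
  where
  no-cofactor : ∀ r c → Prime r → k ≡ c * r → ¬ k * N ∣ b ^ c ∸ 1
  no-cofactor r c pr k≡c*r with stars r pr (divides c k≡c*r)
  ... | star@(_ , r∣N , exact) = exact⇒¬∣^cofactor b pr r∣N exact 4∣k⇒4∣N c k≡c*r
    where
    4∣k⇒4∣N : r ≡ 2 → 4 ∣ k → 4 ∣ N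
    4∣k⇒4∣N r≡2 4∣k with N % 4 ≟ 2
    ... | yes N%4≡2 = contradiction 4∣k (2-star⇒4∤k (subst (StarPrime N (b ∸ 1)) r≡2 star) N%4≡2)
    ... | no N%4≢2 = even∧%4≢2⇒4∣ (subst (_∣ N) r≡2 r∣N) N%4≢2

IsOrd-*⇔ : .{{_ : NonZero b}} .{{_ : NonZero k}} .{{_ : NonZero N}} → N ∣ b ∸ 1 →
  IsOrd (k * N) b k ⇔
    ((∀ r → Prime r → r ∣ k → StarPrime N (b ∸ 1) r) ×
     (StarPrime N (b ∸ 1) 2 → N % 4 ≡ 2 → ¬ 4 ∣ k))
IsOrd-*⇔ N∣b∸1 = mk⇔
  (λ ord → (λ _ → IsOrd⇒star N∣b∸1 ord) , IsOrd⇒¬4∣ N∣b∸1 ord)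
  (λ (stars , 2-star⇒4∤k) → star⇒IsOrd N∣b∸1 stars 2-star⇒4∤k)

equal-valuations⇔ : .{{_ : NonZero N}} → Prime r → N ∣ x →
  (∃[ i ] IsVal r N i × IsVal r x i) ⇔ (¬ r * N ∣ x)
equal-valuations⇔ {N} {r} {x} pr N∣x = mk⇔ to from
  where
  to : ∃[ i ] IsVal r N i × IsVal r x i → ¬ r * N ∣ x
  to (i , (r^i∣N , _) , (_ , maximal)) rN∣x =
    1+n≰n (maximal (suc i) (∣-trans (*-monoʳ-∣ r r^i∣N) rN∣x))
  from : ¬ r * N ∣ x → ∃[ i ] IsVal r N i × IsVal r x i
  from rN∤x with valuation-split (prime⇒1< pr) N (>-nonZero⁻¹ N)
  ... | i , u , N≡r^i*u , r∤u = i , IsVal-split pr N≡r^i*u r∤u , IsVal-split pr x≡r^i*[q*u] r∤q*u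
    where
    open _∣_ N∣x renaming (quotient to q; equality to x≡q*N)
    x≡r^i*[q*u] : x ≡ r ^ i * (q * u)
    x≡r^i*[q*u] = trans x≡q*N (trans (cong (q *_) N≡r^i*u) (regroup q (r ^ i) u))
      where
      regroup : ∀ q a u → q * (a * u) ≡ a * (q * u)
      regroup = solve-∀
    r∤q*u : ¬ r ∣ q * u
    r∤q*u r∣q*u = [ (λ r∣q → rN∤x (subst (r * N ∣_) (sym x≡q*N) (*-monoˡ-∣ N r∣q))) , r∤u ]′
                    (euclidsLemma q u pr r∣q*u)

InPiStar⇔StarPrime : ∀ q m′ r {n′} .{{_ : NonZero n′}} → n′ ∣ q ^ m′ ∸ 1 →
  InPiStar q n′ m′ r ⇔ StarPrime n′ (q ^ m′ ∸ 1) r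
InPiStar⇔StarPrime q m′ r n′∣q^m′∸1 = mk⇔
  (λ ((pr , r∣n′) , same-ν) → pr , r∣n′ , n′∣q^m′∸1 , Equivalence.to (same-ν⇔ pr) same-ν)
  (λ (pr , r∣n′ , _ , rn′∤) → (pr , r∣n′) , Equivalence.from (same-ν⇔ pr) rn′∤)
  where
  same-ν⇔ = λ pr → equal-valuations⇔ {r = r} pr n′∣q^m′∸1

ν₂≤1⇔¬4∣ : .{{_ : NonZero k}} → (∃[ i ] IsVal 2 k i × i ≤ 1) ⇔ (¬ 4 ∣ k)
ν₂≤1⇔¬4∣ {k} = mk⇔ to from
  where
  to : ∃[ i ] IsVal 2 k i × i ≤ 1 → ¬ 4 ∣ k
  to (i , (_ , maximal) , i≤1) 4∣k = <⇒≱ (s≤s i≤1) (maximal 2 4∣k)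
  from : ¬ 4 ∣ k → ∃[ i ] IsVal 2 k i × i ≤ 1
  from 4∤k with valuation-split (s≤s (s≤s z≤n)) k (>-nonZero⁻¹ k)
  ... | i , u , k≡2^i*u , 2∤u = i , IsVal-split prime[2] k≡2^i*u 2∤u , i≤1
    where
    i≤1 : i ≤ 1
    i≤1 with i ≤? 1
    ... | yes i≤1 = i≤1
    ... | no i≰1 =
      contradiction (∣-trans (^-monoʳ-∣ 2 (≰⇒> i≰1)) (divides u (trans k≡2^i*u (*-comm _ u)))) 4∤k

proposition4p4 : (q n n′ k m′ : ℕ) → 2 ≤ q → 0 < n′ → 0 < k → n ≡ k * n′ → Coprime n q →
    IsOrd n′ q m′ →
    (IsOrd (k * n′) q (k * m′) ⇔
      ((∀ r → InPi r k → InPiStar q n′ m′ r) ×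
       (InPiStar q n′ m′ 2 → n′ % 4 ≡ 2 → ∃[ i ] (IsVal 2 k i × i ≤ 1))))
proposition4p4 q n n′ k m′ 2≤q 0<n′ 0<k _ _ ord-n′ =
  ⇔.trans (IsOrd-^⇔ ord-n′ (n∣m*n k))
  (⇔.trans (IsOrd-*⇔ n′∣q^m′∸1)
           (stars⇔ ×-⇔ →-cong-⇔ (⇔.sym (star⇔ 2)) (→-cong-⇔ ⇔.refl (⇔.sym ν₂≤1⇔¬4∣))))
  where
  instance
    _ = >-nonZero (<-trans z<s 2≤q)
    _ = >-nonZero 0<n′
    _ = >-nonZero 0<k
    _ = m^n≢0 q m′
  n′∣q^m′∸1 : n′ ∣ q ^ m′ ∸ 1
  n′∣q^m′∸1 = proj₁ (proj₂ ord-n′)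
  star⇔ : ∀ r → InPiStar q n′ m′ r ⇔ StarPrime n′ (q ^ m′ ∸ 1) r
  star⇔ r = InPiStar⇔StarPrime q m′ r n′∣q^m′∸1
  stars⇔ : (∀ r → Prime r → r ∣ k → StarPrime n′ (q ^ m′ ∸ 1) r) ⇔ (∀ r → InPi r k → InPiStar q n′ m′ r)
  stars⇔ = mk⇔ (λ stars r (pr , r∣k) → Equivalence.from (star⇔ r) (stars r pr r∣k))
               (λ stars r pr r∣k → Equivalence.to (star⇔ r) (stars r (pr , r∣k)))
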